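{- Let $H$ be a gated subgraph of a median graph $G$. Then for every $x\in V(H)$, the total boundary $\partial^*F(x)$ of the fiber $F(x)$ of $H$ induces an isometric subgraph of $G$.
   Context: $d_G$ is the shortest-path distance, $I(u,v)=\{w: d_G(u,w)+d_G(w,v)=d_G(u,v)\}$. $G$ is median if $I(x,y)\cap I(y,z)\cap I(z,x)$ is a single vertex for all $x,y,z$. A subgraph $H$ is gated if every vertex $v$ has a vertex $v'\in V(H)$ (its gate) with $d_G(v,u)=d_G(v,v')+d_G(v',u)$ for all $u\in V(H)$; the fiber $F(x)$ of $x\in V(H)$ is the set of vertices with gate $x$. Fibers $F(x),F(y)$ are neighboring if some edge joins them; then $\partial_yF(x)$ is the set of vertices of $F(x)$ having a neighbor in $F(y)$. The total boundary $\partial^*F(x)$ is the union of all $\partial_yF(x)$ over all fibers $F(y)$ neighboring $F(x)$. A subgraph $S$ is isometric if $d_S(u,v)=d_G(u,v)$ for all $u,v\in V(S)$. -}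

module Defs where

open import Data.Nat using (ℕ; zero; suc; _+_; _≤_)
open import Data.Product using (Σ; ∃; _×_; _,_)
open import Data.Unit using (⊤)
open import Relation.Nullary using (¬_)
open import Relation.Binary.PropositionalEquality using (_≡_)

record Graph : Set₁ where
  field
    V     : Set
    E     : V → V → Set
    sym   : ∀ {u v} → E u v → E v u
    irrefl : ∀ {u} → ¬ E u u

module _ (G : Graph) where
  open Graph G

  -- Vertex subsets (the induced subgraph on S is meant).
  VSet : Set₁
  VSet = V → Set

  data WalkIn (S : VSet) : V → V → ℕ → Set where
    nil  : ∀ {u} → S u → WalkIn S u u zero
    cons : ∀ {u w v k} → S u → E u w → WalkIn S w v k → WalkIn S u v (suc k)

  DistIn : VSet → V → V → ℕ → Set
  DistIn S u v k = WalkIn S u v k × (∀ m → WalkIn S u v m → k ≤ m)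

  AllV : VSet
  AllV _ = ⊤

  Dist : V → V → ℕ → Set
  Dist = DistIn AllV

  Connected : Set
  Connected = ∀ u v → ∃ λ k → Dist u v k

  Interval : V → V → V → Set
  Interval u v w = ∀ a b c → Dist u w a → Dist w v b → Dist u v c → a + b ≡ c

  IsMedian : Set
  IsMedian = Connected ×
    (∀ x y z → Σ V λ m → (Interval x y m × Interval y z m × Interval z x m)
                         × (∀ m′ → Interval x y m′ → Interval y z m′ → Interval z x m′ → m′ ≡ m))

  IsGate : VSet → V → V → Set
  IsGate H v g = H g × (∀ u → H u → ∀ a b c → Dist v u a → Dist v g b → Dist g u c → a ≡ b + c)

  Gated : VSet → Set
  Gated H = ∀ v → Σ V λ g → IsGate H v g

  Fiber : VSet → V → VSet
  Fiber H x v = IsGate H v x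

  BoundaryTo : VSet → V → V → VSet
  BoundaryTo H x y v = Fiber H x v × (∃ λ w → E v w × Fiber H y w)

  -- Total boundary ∂* F(x): union of ∂_y F(x) over all y ∈ H, y ≠ x
  -- (F(y) neighbouring F(x) is witnessed by the edge itself).
  TotalBoundary : VSet → V → VSet
  TotalBoundary H x v = ∃ λ y → H y × ¬ (y ≡ x) × BoundaryTo H x y v

  Isometric : VSet → Set
  Isometric S = ∀ u v → S u → S v → ∀ k → Dist u v k → DistIn S u v k

-- Write d for the distance of the (connected) graph and I(a,b) for the interval.
-- The proof only uses the existence of medians and rests on two facts.
--
--  (1) Interval-closed sets.  If every vertex s of S has I(s,x) ⊆ S for one
--      fixed vertex x, then S is isometric: for u,v ∈ S take the median m of
--      u,v,x; then I(u,m) ⊆ I(u,x) ⊆ S and I(m,v) ⊆ I(v,x) ⊆ S, so geodesics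
--      u→m and m→v inside S concatenate to a geodesic u→v inside S.
--  (2) Boundary intervals.  If a ∈ ∂_y F(x), witnessed by an edge a a' with
--      a' ∈ F(y), then I(a,x) ⊆ ∂* F(x).  Gates of adjacent vertices in
--      different fibers are adjacent and equidistant; for t ∈ I(a,x) the gate
--      of t is still x, and the median m of a',t,y is a neighbour of t whose
--      gate is y.

module Submission where

open import Defs
open import Data.Nat
open import Data.Nat.Properties
open import Data.Nat.Tactic.RingSolver using (solve-∀)
open import Data.Product
open import Data.Unit using (tt)
open import Data.Empty using (⊥-elim)
open import Relation.Nullary using (¬_)
open import Relation.Binary.PropositionalEquality

-- Distances of two adjacent vertices a, a' to their gates x, y (with e = d(x,y)
-- ≠ 0): the two triangle inequalities force d(x,y) = 1 and equal distances.
adjacent-gates-arith : ∀ A B e → A + e ≤ suc B → B + e ≤ suc A → ¬ e ≡ 0 →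
                       e ≡ 1 × A ≡ B
adjacent-gates-arith A B zero _ _ e≢0 = ⊥-elim (e≢0 refl)
adjacent-gates-arith A B 1 h₁ h₂ _ = refl , ≤-antisym (drop-one h₁) (drop-one h₂)
  where
  drop-one : ∀ {m n} → m + 1 ≤ suc n → m ≤ n
  drop-one {m} {n} h = s≤s⁻¹ (subst (_≤ suc n) (+-comm m 1) h)
adjacent-gates-arith A B (suc (suc f)) h₁ h₂ _ = ⊥-elim (<-asym (drop-two h₁) (drop-two h₂))
  where
  drop-two : ∀ {m n} → m + suc (suc f) ≤ suc n → m < n
  drop-two {m} {n} h = s≤s⁻¹ (≤-trans (s≤s (s≤s (m≤m+n m f)))
    (subst (_≤ suc n) (trans (+-suc m (suc f)) (cong suc (+-suc m f))) h))

legs-rearrange : ∀ A B C → B + B + (C + A) ≡ A + B + (B + C)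
legs-rearrange = solve-∀

-- The three legs A = d(a',m), B = d(m,t), C = d(m,y) of a median triangle with
-- side lengths p+1, q+1 and p+q: the leg B towards t has length 1.
median-leg-one : ∀ A B C p q → A + B ≡ suc p → B + C ≡ suc q → C + A ≡ p + q → B ≡ 1
median-leg-one A B C p q h₁ h₂ h₃ = half B (+-cancelʳ-≡ (C + A) (B + B) 2 twice)
  where
  open ≡-Reasoning
  half : ∀ n → n + n ≡ 2 → n ≡ 1
  half 0 ()
  half 1 _ = refl
  half (suc (suc n)) h with trans (sym (+-suc n (suc n))) (suc-injective (suc-injective h))
  ... | ()
  twice : B + B + (C + A) ≡ 2 + (C + A)
  twice = begin
    B + B + (C + A)   ≡⟨ legs-rearrange A B C ⟩
    A + B + (B + C)   ≡⟨ cong₂ _+_ h₁ h₂ ⟩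
    suc p + suc q     ≡⟨ cong suc (+-suc p q) ⟩
    2 + (p + q)       ≡⟨ cong (2 +_) (sym h₃) ⟩
    2 + (C + A)       ∎

module Metric (G : Graph) (connected : Connected G) where
  open Graph G renaming (sym to E-sym)

  Walk : V → V → ℕ → Set
  Walk = WalkIn G (AllV G)

  d : V → V → ℕ
  d u v = proj₁ (connected u v)

  geodesic : ∀ u v → Walk u v (d u v)
  geodesic u v = proj₁ (proj₂ (connected u v))

  d-minimal : ∀ {u v m} → Walk u v m → d u v ≤ m
  d-minimal {u} {v} {m} w = proj₂ (proj₂ (connected u v)) m w

  Dist-d : ∀ u v → Dist G u v (d u v)
  Dist-d u v = geodesic u v , λ _ → d-minimal

  Dist-unique : ∀ {u v k} → Dist G u v k → k ≡ d u v
  Dist-unique {u} {v} (w , min) = ≤-antisym (min _ (geodesic u v)) (d-minimal w)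

  _++ʷ_ : ∀ {S u v w j k} → WalkIn G S u v j → WalkIn G S v w k → WalkIn G S u w (j + k)
  nil _       ++ʷ q = q
  cons s e p  ++ʷ q = cons s e (p ++ʷ q)

  forget : ∀ {S u v k} → WalkIn G S u v k → Walk u v k
  forget (nil _)      = nil tt
  forget (cons _ e p) = cons tt e (forget p)

  snoc : ∀ {u v w k} → Walk u v k → E v w → Walk u w (suc k)
  snoc (nil _)       e = cons tt e (nil tt)
  snoc (cons _ e′ p) e = cons tt e′ (snoc p e)

  reverse : ∀ {u v k} → Walk u v k → Walk v u k
  reverse (nil _)      = nil tt
  reverse (cons _ e p) = snoc (reverse p) (E-sym e)

  d-sym : ∀ u v → d u v ≡ d v u
  d-sym u v = ≤-antisym (d-minimal (reverse (geodesic v u))) (d-minimal (reverse (geodesic u v)))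

  d-triangle : ∀ u v w → d u w ≤ d u v + d v w
  d-triangle u v w = d-minimal (geodesic u v ++ʷ geodesic v w)

  d-edge : ∀ {u v} → E u v → d u v ≤ 1
  d-edge e = d-minimal (cons tt e (nil tt))

  d-self : ∀ u → d u u ≡ 0
  d-self u = n≤0⇒n≡0 (d-minimal (nil tt))

  d≡0⇒≡ : ∀ {u v} → d u v ≡ 0 → u ≡ v
  d≡0⇒≡ {u} {v} eq with d u v | geodesic u v
  d≡0⇒≡ refl | .0 | nil _ = refl

  d≡1⇒E : ∀ {u v} → d u v ≡ 1 → E u v
  d≡1⇒E {u} {v} eq with d u v | geodesic u v
  d≡1⇒E refl | .1 | cons _ e (nil _) = e

  Between : V → V → V → Set
  Between a t b = d a t + d t b ≡ d a b

  Interval⇒Between : ∀ {a b t} → Interval G a b t → Between a t b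
  Interval⇒Between {a} {b} {t} i = i _ _ _ (Dist-d a t) (Dist-d t b) (Dist-d a b)

  between-sym : ∀ {a t b} → Between a t b → Between b t a
  between-sym {a} {t} {b} bt = begin
    d b t + d t a ≡⟨ cong₂ _+_ (d-sym b t) (d-sym t a) ⟩
    d t b + d a t ≡⟨ +-comm (d t b) (d a t) ⟩
    d a t + d t b ≡⟨ bt ⟩
    d a b         ≡⟨ d-sym a b ⟩
    d b a         ∎
    where open ≡-Reasoning

  between-trans : ∀ {a t b c} → Between a t b → Between a b c → Between a t c
  between-trans {a} {t} {b} {c} t∈ab b∈ac = ≤-antisym
    (begin d a t + d t c         ≤⟨ +-monoʳ-≤ (d a t) (d-triangle t b c) ⟩
           d a t + (d t b + d b c) ≡⟨ sym (+-assoc (d a t) (d t b) (d b c)) ⟩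
           d a t + d t b + d b c ≡⟨ cong (_+ d b c) t∈ab ⟩
           d a b + d b c         ≡⟨ b∈ac ⟩
           d a c                 ∎)
    (d-triangle a t c)
    where open ≤-Reasoning

  geodesic-step : ∀ {a b t w j} → E t w → Walk w b j → d a t + suc j ≡ d a b →
                  Between a t b × d a w + j ≡ d a b
  geodesic-step {a} {b} {t} {w} {j} e p eq =
    ≤-antisym (begin d a t + d t b ≤⟨ +-monoʳ-≤ (d a t) (d-minimal (cons tt e p)) ⟩
                     d a t + suc j ≡⟨ eq ⟩
                     d a b         ∎)
              (d-triangle a t b) ,
    ≤-antisym (begin d a w + j         ≤⟨ +-monoˡ-≤ j (d-triangle a t w) ⟩
                     d a t + d t w + j ≤⟨ +-monoˡ-≤ j (+-monoʳ-≤ (d a t) (d-edge e)) ⟩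
                     d a t + 1 + j     ≡⟨ +-assoc (d a t) 1 j ⟩
                     d a t + suc j     ≡⟨ eq ⟩
                     d a b             ∎)
              (begin d a b             ≤⟨ d-triangle a w b ⟩
                     d a w + d w b     ≤⟨ +-monoʳ-≤ (d a w) (d-minimal p) ⟩
                     d a w + j         ∎)
    where open ≤-Reasoning

  -- Every vertex of a geodesic lies in the interval, so a geodesic of G
  -- between a and b runs inside any vertex set containing I(a,b).
  geodesic-inside : (S : V → Set) (a b : V) → (∀ t → Between a t b → S t) →
                    WalkIn G S a b (d a b)
  geodesic-inside S a b I⊆S = follow (geodesic a b) (cong (_+ d a b) (d-self a))
    where
    follow : ∀ {t j} → Walk t b j → d a t + j ≡ d a b → WalkIn G S t b j
    follow {t} (nil _) eq = nil (I⊆S t (trans (cong (d a t +_) (d-self t)) eq))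
    follow {t} (cons _ e p) eq =
      let t∈I , next = geodesic-step e p eq in cons (I⊆S t t∈I) e (follow p next)

  isometric-by-geodesics : (S : V → Set) → (∀ u v → S u → S v → WalkIn G S u v (d u v)) →
                           Isometric G S
  isometric-by-geodesics S path u v Su Sv k dist =
    subst (WalkIn G S u v) (sym (Dist-unique dist)) (path u v Su Sv) ,
    λ m w → proj₂ dist m (forget w)

  -- Existence of medians.
  HasMedians : Set
  HasMedians = ∀ x y z → Σ V λ m → Between x m y × Between y m z × Between z m x

  -- Fact (1): a set closed under intervals towards one fixed vertex x is
  -- isometric, as the geodesic through the median of u, v, x stays inside.
  closed-towards-isometric : HasMedians → (x : V) (S : V → Set) →
                             (∀ s t → S s → Between s t x → S t) → Isometric G S
  closed-towards-isometric medians x S closed = isometric-by-geodesics S path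
    where
    path : ∀ u v → S u → S v → WalkIn G S u v (d u v)
    path u v Su Sv = subst (WalkIn G S u v) m∈uv (to-median ++ʷ from-median)
      where
      m = proj₁ (medians u v x)
      m∈uv : Between u m v
      m∈uv = proj₁ (proj₂ (medians u v x))
      m∈vx : Between v m x
      m∈vx = proj₁ (proj₂ (proj₂ (medians u v x)))
      m∈ux : Between u m x
      m∈ux = between-sym (proj₂ (proj₂ (proj₂ (medians u v x))))
      to-median : WalkIn G S u m (d u m)
      to-median = geodesic-inside S u m λ t t∈um →
        closed u t Su (between-trans t∈um m∈ux)
      from-median : WalkIn G S m v (d m v)
      from-median = geodesic-inside S m v λ t t∈mv →
        closed v t Sv (between-trans (between-sym t∈mv) m∈vx)

  module Gates (H : V → Set) where

    gate-distance : ∀ {v g} → IsGate G H v g → ∀ h → H h → d v h ≡ d v g + d g h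
    gate-distance {v} {g} (_ , gate) h Hh = gate h Hh _ _ _ (Dist-d v h) (Dist-d v g) (Dist-d g h)

    distance⇒gate : ∀ {v g} → H g → (∀ h → H h → d v h ≡ d v g + d g h) → IsGate G H v g
    distance⇒gate Hg split = Hg , λ h Hh _ _ _ dist-vh dist-vg dist-gh →
      trans (Dist-unique dist-vh)
        (trans (split h Hh) (cong₂ _+_ (sym (Dist-unique dist-vg)) (sym (Dist-unique dist-gh))))

    gate-along-interval : ∀ {a x t} → IsGate G H a x → Between a t x → IsGate G H t x
    gate-along-interval {a} {x} {t} gx t∈ax = distance⇒gate (proj₁ gx) λ h Hh →
      ≤-antisym (d-triangle t x h)
        (+-cancelˡ-≤ (d a t) (d t x + d x h) (d t h)
          (begin d a t + (d t x + d x h) ≡⟨ sym (+-assoc (d a t) (d t x) (d x h)) ⟩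
                 d a t + d t x + d x h   ≡⟨ cong (_+ d x h) t∈ax ⟩
                 d a x + d x h           ≡⟨ sym (gate-distance gx h Hh) ⟩
                 d a h                   ≤⟨ d-triangle a t h ⟩
                 d a t + d t h           ∎))
      where open ≤-Reasoning

    adjacent-fibers : ∀ {a a' x y} → IsGate G H a x → E a a' → IsGate G H a' y → ¬ y ≡ x →
                      d x y ≡ 1 × d a x ≡ d a' y
    adjacent-fibers {a} {a'} {x} {y} gx e gy y≢x =
      adjacent-gates-arith (d a x) (d a' y) (d x y) via-a via-a' (λ dxy≡0 → y≢x (sym (d≡0⇒≡ dxy≡0)))
      where
      open ≤-Reasoning
      via-a : d a x + d x y ≤ suc (d a' y)
      via-a = begin d a x + d x y   ≡⟨ sym (gate-distance gx y (proj₁ gy)) ⟩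
                    d a y           ≤⟨ d-triangle a a' y ⟩
                    d a a' + d a' y ≤⟨ +-monoˡ-≤ (d a' y) (d-edge e) ⟩
                    suc (d a' y)    ∎
      via-a' : d a' y + d x y ≤ suc (d a x)
      via-a' = begin d a' y + d x y ≡⟨ cong (d a' y +_) (d-sym x y) ⟩
                     d a' y + d y x ≡⟨ sym (gate-distance gy x (proj₁ gx)) ⟩
                     d a' x         ≤⟨ d-triangle a' a x ⟩
                     d a' a + d a x ≤⟨ +-monoˡ-≤ (d a x) (d-edge (E-sym e)) ⟩
                     suc (d a x)    ∎

    -- With p = d(a,t), q = d(t,x) one gets d(a',y) = p+q, d(a',t) = p+1,
    -- d(t,y) = q+1; the median m of a', t, y is then a neighbour of t in F(y).
    boundary-interval : HasMedians → ∀ {a a' x y} → IsGate G H a x → E a a' →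
                        IsGate G H a' y → ¬ y ≡ x →
                        ∀ t → Between a t x → TotalBoundary G H x t
    boundary-interval medians {a} {a'} {x} {y} gx e gy y≢x t t∈ax =
      y , proj₁ gy , y≢x , gt , m , d≡1⇒E (trans (d-sym t m) d[m,t]≡1) , gm
      where
      open ≤-Reasoning
      p = d a t
      q = d t x
      gates = adjacent-fibers gx e gy y≢x
      gt : IsGate G H t x
      gt = gate-along-interval gx t∈ax
      d[a',y] : d a' y ≡ p + q
      d[a',y] = trans (sym (proj₂ gates)) (sym t∈ax)
      d[a',x] : d a' x ≡ suc (p + q)
      d[a',x] = trans (gate-distance gy x (proj₁ gx))
        (trans (cong₂ _+_ d[a',y] (trans (d-sym y x) (proj₁ gates))) (+-comm (p + q) 1))
      d[a',t] : d a' t ≡ suc p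
      d[a',t] = ≤-antisym
        (begin d a' t     ≤⟨ d-triangle a' a t ⟩
               d a' a + p ≤⟨ +-monoˡ-≤ p (d-edge (E-sym e)) ⟩
               suc p      ∎)
        (+-cancelʳ-≤ q (suc p) (d a' t)
          (begin suc p + q  ≡⟨ sym d[a',x] ⟩
                 d a' x     ≤⟨ d-triangle a' t x ⟩
                 d a' t + q ∎))
      d[t,y] : d t y ≡ suc q
      d[t,y] = trans (gate-distance gt y (proj₁ gy)) (trans (cong (q +_) (proj₁ gates)) (+-comm q 1))
      m = proj₁ (medians a' t y)
      m∈a't : Between a' m t
      m∈a't = proj₁ (proj₂ (medians a' t y))
      m∈ty : Between t m y
      m∈ty = proj₁ (proj₂ (proj₂ (medians a' t y)))
      m∈ya' : Between y m a'
      m∈ya' = proj₂ (proj₂ (proj₂ (medians a' t y)))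
      d[m,t]≡1 : d m t ≡ 1
      d[m,t]≡1 = median-leg-one (d a' m) (d m t) (d m y) p q
        (trans m∈a't d[a',t])
        (trans (cong (_+ d m y) (d-sym m t)) (trans m∈ty d[t,y]))
        (trans (+-comm (d m y) (d a' m)) (trans (between-sym m∈ya') d[a',y]))
      gm : IsGate G H m y
      gm = gate-along-interval gy (between-sym m∈ya')

lemma15 : (G : Graph) → IsMedian G → (H : Graph.V G → Set) → Gated G H →
    ∀ x → H x → Isometric G (TotalBoundary G H x)
lemma15 G (connected , median) H _ x _ =
  closed-towards-isometric medians x (TotalBoundary G H x) closed
  where
  open Metric G connected
  open Gates H

  medians : HasMedians
  medians a b c =
    let m , (m∈ab , m∈bc , m∈ca) , _ = median a b c
    in m , Interval⇒Between m∈ab , Interval⇒Between m∈bc , Interval⇒Between m∈ca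

  closed : ∀ s t → TotalBoundary G H x s → Between s t x → TotalBoundary G H x t
  closed s t (y , _ , y≢x , gs , _ , e , gs′) =
    boundary-interval medians gs e gs′ y≢x t
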